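{- Let $G$ be an $r$-regular graph of order $n$. Then (i) $\gamma^{NN}_{s}(G)=n-2L_{\lfloor\frac{r+1}{2}\rfloor}(G)$; (ii) $\gamma^{NN}_{s}(G)=2\gamma_{\times\lceil\frac{r+1}{2}\rceil}(G)-n$.
   Context: All graphs are finite and simple. For a vertex $v$, $N[v]$ denotes its closed neighborhood $N(v)\cup\{v\}$; for $f:V(G)\to\mathbb{R}$ and $S\subseteq V(G)$, $f(S)=\sum_{v\in S}f(v)$. A nonnegative signed dominating function (NNSDF) of $G$ is a function $f:V(G)\to\{ -1,1\}$ with $f(N[v])\ge 0$ for every $v\in V(G)$; the nonnegative signed domination number $\gamma^{NN}_s(G)$ is the minimum of $f(V(G))$ over all NNSDFs $f$ of $G$. A set $B\subseteq V(G)$ is a $k$-limited packing if $|N[v]\cap B|\le k$ for all $v\in V(G)$; $L_k(G)$ is the maximum size of a $k$-limited packing. A set $D\subseteq V(G)$ is a $k$-tuple dominating set if $|N[v]\cap D|\ge k$ for all $v\in V(G)$; $\gamma_{\times k}(G)$ is the minimum size of a $k$-tuple dominating set. -}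

module Defs where

open import Data.Nat using (ℕ; zero; suc; _+_; _≤_)
open import Data.Integer as ℤ using (ℤ; +_; 0ℤ; 1ℤ; -1ℤ)
open import Data.Fin using (Fin; zero; suc; _≟_)
open import Data.Bool using (Bool; true; false; if_then_else_; _∨_)
open import Data.Product using (Σ; _×_)
open import Relation.Nullary using (does)
open import Relation.Binary.PropositionalEquality using (_≡_)

record Graph (n : ℕ) : Set where
  field
    adj    : Fin n → Fin n → Bool
    sym    : ∀ u v → adj u v ≡ adj v u
    irrefl : ∀ v → adj v v ≡ false
open Graph public

VSet : ℕ → Set
VSet n = Fin n → Bool

count : ∀ {n} → VSet n → ℕ
count {zero}  S = 0
count {suc n} S = (if S zero then 1 else 0) + count (λ i → S (suc i))

_∩_ : ∀ {n} → VSet n → VSet n → VSet n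
(A ∩ B) v = Data.Bool._∧_ (A v) (B v)

sumℤ : ∀ {n} → (Fin n → ℤ) → VSet n → ℤ
sumℤ {zero}  g S = 0ℤ
sumℤ {suc n} g S = (if S zero then g zero else 0ℤ) ℤ.+ sumℤ (λ i → g (suc i)) (λ i → S (suc i))

V : ∀ {n} → VSet n
V _ = true

Nbr : ∀ {n} → Graph n → Fin n → VSet n
Nbr G v u = adj G v u

NbrC : ∀ {n} → Graph n → Fin n → VSet n
NbrC G v u = does (u ≟ v) ∨ adj G v u

degree : ∀ {n} → Graph n → Fin n → ℕ
degree G v = count (Nbr G v)

Regular : ∀ {n} → Graph n → ℕ → Set
Regular G r = ∀ v → degree G v ≡ r

Sign : ℕ → Set
Sign n = Fin n → Bool

val : ∀ {n} → Sign n → Fin n → ℤ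
val f v = if f v then 1ℤ else -1ℤ

fsum : ∀ {n} → Sign n → VSet n → ℤ
fsum f S = sumℤ (val f) S

IsNNSDF : ∀ {n} → Graph n → Sign n → Set
IsNNSDF G f = ∀ v → 0ℤ ℤ.≤ fsum f (NbrC G v)

IsNNSDNumber : ∀ {n} → Graph n → ℤ → Set
IsNNSDNumber G g =
  Σ (Sign _) (λ f → IsNNSDF G f × fsum f V ≡ g)
  × (∀ f → IsNNSDF G f → g ℤ.≤ fsum f V)

IsLimitedPacking : ∀ {n} → Graph n → ℕ → VSet n → Set
IsLimitedPacking G k B = ∀ v → count (NbrC G v ∩ B) ≤ k

IsLkNumber : ∀ {n} → Graph n → ℕ → ℕ → Set
IsLkNumber G k l =
  Σ (VSet _) (λ B → IsLimitedPacking G k B × count B ≡ l)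
  × (∀ B → IsLimitedPacking G k B → count B ≤ l)

IsTupleDom : ∀ {n} → Graph n → ℕ → VSet n → Set
IsTupleDom G k D = ∀ v → k ≤ count (NbrC G v ∩ D)

IsTupleDomNumber : ∀ {n} → Graph n → ℕ → ℕ → Set
IsTupleDomNumber G k d =
  Σ (VSet _) (λ D → IsTupleDom G k D × count D ≡ d)
  × (∀ D → IsTupleDom G k D → d ≤ count D)

-- A sign function f is the complement of its set B of (-1)-vertices, and
-- f(V) = n - 2|B|.  In an r-regular graph every closed neighbourhood has r+1
-- vertices, so f(N[v]) ≥ 0 says exactly that N[v] contains at most ⌊(r+1)/2⌋
-- vertices of B, equivalently at least ⌈(r+1)/2⌉ vertices outside B.  Hence
-- nonnegative signed dominating functions, ⌊(r+1)/2⌋-limited packings and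
-- complements of ⌈(r+1)/2⌉-tuple dominating sets are the same objects, and
-- minimising f(V) is maximising |B|.

module Submission where

open import Defs
open import Data.Nat using (ℕ; suc; ⌊_/2⌋; ⌈_/2⌉)
open import Data.Integer using (ℤ; +_; _-_; _*_)
open import Data.Product using (Σ; _×_)
open import Relation.Binary.PropositionalEquality using (_≡_)

open import Data.Nat as ℕ using (zero; _≤_; _<_; _∸_; z≤n; s≤s; _<?_)
import Data.Nat.Properties as ℕ
open import Data.Nat.Induction using (<-wellFounded)
import Data.Integer as ℤ
import Data.Integer.Properties as ℤ
open import Data.Integer.Tactic.RingSolver using (solve-∀)
open import Data.Fin using (Fin; zero; suc; _≟_)
open import Data.Fin.Properties using (all?)
open import Data.Fin.Subset.Properties using (anySubset?)
open import Data.Vec using (lookup; tabulate)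
open import Data.Vec.Properties using (lookup∘tabulate)
open import Data.Bool using (true; false; not; _∧_; _∨_)
open import Data.Bool.Properties using (not-involutive; ∧-zeroʳ)
open import Data.Product using (_,_)
open import Function using (_∘_)
open import Induction.WellFounded using (Acc; acc)
open import Relation.Nullary using (yes; no; does)
open import Relation.Nullary.Decidable using (_×-dec_)
open import Relation.Unary using (Decidable)
import Relation.Binary.PropositionalEquality as ≡
open import Relation.Binary.PropositionalEquality
  using (refl; trans; cong; subst; _≗_; module ≡-Reasoning)

private
  variable
    n : ℕ

count-cong : {S T : VSet n} → S ≗ T → count S ≡ count T
count-cong {zero}  S≗T = refl
count-cong {suc n} S≗T rewrite S≗T zero = cong (_ ℕ.+_) (count-cong (S≗T ∘ suc))

count-≤ : (S : VSet n) → count S ≤ n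
count-≤ {zero}  S = z≤n
count-≤ {suc n} S with S zero
... | true  = s≤s (count-≤ (S ∘ suc))
... | false = ℕ.m≤n⇒m≤1+n (count-≤ (S ∘ suc))

count-V : count (V {n}) ≡ n
count-V {zero}  = refl
count-V {suc n} = cong suc (count-V {n})

count-∅ : count {n} (λ _ → false) ≡ 0
count-∅ {zero}  = refl
count-∅ {suc n} = count-∅ {n}

count-∩-not : (S T : VSet n) → count (S ∩ T) ℕ.+ count (S ∩ (not ∘ T)) ≡ count S
count-∩-not {zero}  S T = refl
count-∩-not {suc n} S T with S zero | T zero | count-∩-not (S ∘ suc) (T ∘ suc)
... | true  | true  | ih = cong suc ih
... | true  | false | ih = trans (ℕ.+-suc _ _) (cong suc ih)
... | false | _     | ih = ih

count-complement : (S : VSet n) → count S ℕ.+ count (not ∘ S) ≡ n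
count-complement S = trans (count-∩-not V S) count-V

count-not : (S : VSet n) → count (not ∘ S) ≡ n ∸ count S
count-not S = trans (≡.sym (ℕ.m+n∸m≡n (count S) _)) (cong (_∸ count S) (count-complement S))

count-not-not : (S : VSet n) → count (not ∘ not ∘ S) ≡ count S
count-not-not S = count-cong (not-involutive ∘ S)

∸-count-not : (S : VSet n) → n ∸ count (not ∘ S) ≡ count S
∸-count-not S = trans (≡.sym (count-not (not ∘ S))) (count-not-not S)

count-insert : (v : Fin n) (A : VSet n) → A v ≡ false →
               count (λ u → does (u ≟ v) ∨ A u) ≡ suc (count A)
count-insert zero    A Av≡false rewrite Av≡false = refl
count-insert (suc v) A Av≡false =
  trans (cong (_ ℕ.+_) (trans (count-cong same) (count-insert v (A ∘ suc) Av≡false)))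
        (ℕ.+-suc _ _)
  where
  same : (λ u → does (suc u ≟ suc v) ∨ A (suc u)) ≗ (λ u → does (u ≟ v) ∨ A (suc u))
  same u with u ≟ v
  ... | yes _ = refl
  ... | no  _ = refl

Maximum : (VSet n → Set) → Set
Maximum {n} P = Σ (VSet n) λ S → P S × (∀ T → P T → count T ≤ count S)

module _ {P : VSet n → Set} (P? : Decidable P) (P-cong : ∀ {S T} → S ≗ T → P S → P T) where

  private
    climb : ∀ S → P S → Acc _<_ (n ∸ count S) → Maximum P
    climb S pS (acc rs) with anySubset? (λ T → P? (lookup T) ×-dec count S <? count (lookup T))
    ... | yes (T , pT , S<T) =
      climb (lookup T) pT (rs (ℕ.∸-monoʳ-< S<T (count-≤ (lookup T))))
    ... | no ¬beaten = S , pS , λ T pT → ℕ.≮⇒≥ λ S<T →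
      ¬beaten (tabulate T , P-cong (≡.sym ∘ lookup∘tabulate T) pT
                          , subst (count S <_) (≡.sym (count-cong (lookup∘tabulate T))) S<T)

  maximum-exists : ∀ S → P S → Maximum P
  maximum-exists S pS = climb S pS (<-wellFounded _)

private
  1+[x-y]≡[1+x]-y : ∀ x y → ℤ.1ℤ ℤ.+ (x - y) ≡ (ℤ.1ℤ ℤ.+ x) - y
  1+[x-y]≡[1+x]-y = solve-∀

  -1+[x-y]≡x-[1+y] : ∀ x y → ℤ.-1ℤ ℤ.+ (x - y) ≡ x - (ℤ.1ℤ ℤ.+ y)
  -1+[x-y]≡x-[1+y] = solve-∀

fsum-count : (f : Sign n) (S : VSet n) →
             fsum f S ≡ + count (S ∩ f) - + count (S ∩ (not ∘ f))
fsum-count {zero}  f S = refl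
fsum-count {suc n} f S with S zero | f zero | fsum-count (f ∘ suc) (S ∘ suc)
... | true  | true  | ih =
  trans (cong (ℤ._+_ ℤ.1ℤ) ih)
        (1+[x-y]≡[1+x]-y (+ count ((S ∘ suc) ∩ (f ∘ suc)))
                         (+ count ((S ∘ suc) ∩ (not ∘ f ∘ suc))))
... | true  | false | ih =
  trans (cong (ℤ._+_ ℤ.-1ℤ) ih)
        (-1+[x-y]≡x-[1+y] (+ count ((S ∘ suc) ∩ (f ∘ suc)))
                          (+ count ((S ∘ suc) ∩ (not ∘ f ∘ suc))))
... | false | _     | ih = trans (ℤ.+-identityˡ _) ih

fsum-V : (f : Sign n) → fsum f V ≡ + n - + 2 * + count (not ∘ f)
fsum-V {n} f = begin
  fsum f V                      ≡⟨ fsum-count f V ⟩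
  + a - + b                     ≡⟨ x-y≡[x+y]-2y (+ a) (+ b) ⟩
  (+ a ℤ.+ + b) - + 2 * + b     ≡⟨ cong (λ m → + m - + 2 * + b) (count-complement f) ⟩
  + n - + 2 * + b               ∎
  where
  open ≡-Reasoning
  a = count f
  b = count (not ∘ f)
  x-y≡[x+y]-2y : ∀ x y → x - y ≡ (x ℤ.+ y) - + 2 * y
  x-y≡[x+y]-2y = solve-∀

+≡+⇒≤-swap : ∀ {x y x′ y′} → x ℕ.+ y ≡ x′ ℕ.+ y′ → y ≤ y′ → x′ ≤ x
+≡+⇒≤-swap {x} {y} {x′} {y′} eq y≤y′ =
  ℕ.+-cancelʳ-≤ y′ x′ x (subst (_≤ x ℕ.+ y′) eq (ℕ.+-monoʳ-≤ x y≤y′))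

n-2x-antitone : ∀ n {x y} → x ≤ y → + n - + 2 * + y ℤ.≤ + n - + 2 * + x
n-2x-antitone n x≤y =
  ℤ.+-monoʳ-≤ (+ n) (ℤ.neg-mono-≤ (ℤ.*-monoˡ-≤-nonNeg (+ 2) (ℤ.+≤+ x≤y)))

n-2l≡2[n∸l]-n : ∀ {n l} → l ≤ n → + n - + 2 * + l ≡ + 2 * + (n ∸ l) - + n
n-2l≡2[n∸l]-n {n} {l} l≤n = begin
  + n - + 2 * + l              ≡⟨ cong (λ m → m - + 2 * + l) n≡d+l ⟩
  (+ d ℤ.+ + l) - + 2 * + l    ≡⟨ [x+y]-2y≡2x-[x+y] (+ d) (+ l) ⟩
  + 2 * + d - (+ d ℤ.+ + l)    ≡⟨ cong (λ m → + 2 * + d - m) (≡.sym n≡d+l) ⟩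
  + 2 * + d - + n              ∎
  where
  open ≡-Reasoning
  d = n ∸ l
  n≡d+l : + n ≡ + d ℤ.+ + l
  n≡d+l = trans (cong +_ (≡.sym (ℕ.m∸n+n≡m l≤n))) (ℤ.pos-+ d l)
  [x+y]-2y≡2x-[x+y] : ∀ x y → (x ℤ.+ y) - + 2 * y ≡ + 2 * x - (x ℤ.+ y)
  [x+y]-2y≡2x-[x+y] = solve-∀

module _ {a b m : ℕ} (a+b≡m : a ℕ.+ b ≡ m) where

  ≤⇒≤⌊/2⌋ : b ≤ a → b ≤ ⌊ m /2⌋
  ≤⇒≤⌊/2⌋ b≤a = subst (_≤ ⌊ m /2⌋) (≡.sym (ℕ.n≡⌊n+n/2⌋ b))
    (ℕ.⌊n/2⌋-mono (subst (b ℕ.+ b ≤_) (trans (ℕ.+-comm b a) a+b≡m) (ℕ.+-monoʳ-≤ b b≤a)))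

  ≤⌊/2⌋⇒⌈/2⌉≤ : b ≤ ⌊ m /2⌋ → ⌈ m /2⌉ ≤ a
  ≤⌊/2⌋⇒⌈/2⌉≤ = +≡+⇒≤-swap
    (trans a+b≡m (trans (≡.sym (ℕ.⌊n/2⌋+⌈n/2⌉≡n m)) (ℕ.+-comm ⌊ m /2⌋ _)))

  ⌈/2⌉≤⇒≤⌊/2⌋ : ⌈ m /2⌉ ≤ a → b ≤ ⌊ m /2⌋
  ⌈/2⌉≤⇒≤⌊/2⌋ = +≡+⇒≤-swap
    (trans (ℕ.⌊n/2⌋+⌈n/2⌉≡n m) (trans (≡.sym a+b≡m) (ℕ.+-comm a b)))

  ≤⌊/2⌋⇒≤ : b ≤ ⌊ m /2⌋ → b ≤ a
  ≤⌊/2⌋⇒≤ b≤⌊m/2⌋ =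
    ℕ.≤-trans b≤⌊m/2⌋ (ℕ.≤-trans (ℕ.⌊n/2⌋≤⌈n/2⌉ m) (≤⌊/2⌋⇒⌈/2⌉≤ b≤⌊m/2⌋))

module _ (G : Graph n) where

  IsNNSDNumber-unique : ∀ {g g′} → IsNNSDNumber G g → IsNNSDNumber G g′ → g ≡ g′
  IsNNSDNumber-unique ((f , f-nn , f≡g) , g-min) ((f′ , f′-nn , f′≡g′) , g′-min) =
    ℤ.≤-antisym (subst (_ ℤ.≤_) f′≡g′ (g-min f′ f′-nn))
                (subst (_ ℤ.≤_) f≡g (g′-min f f-nn))

  IsTupleDomNumber-unique : ∀ {k d d′} →
                            IsTupleDomNumber G k d → IsTupleDomNumber G k d′ → d ≡ d′
  IsTupleDomNumber-unique ((D , D-dom , D≡d) , d-min) ((D′ , D′-dom , D′≡d′) , d′-min) =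
    ℕ.≤-antisym (subst (_ ≤_) D′≡d′ (d-min D′ D′-dom))
                (subst (_ ≤_) D≡d (d′-min D D-dom))

  packing-cong : ∀ {k B B′} → B ≗ B′ → IsLimitedPacking G k B → IsLimitedPacking G k B′
  packing-cong B≗B′ B-pack v =
    subst (_≤ _) (count-cong (λ u → cong (NbrC G v u ∧_) (B≗B′ u))) (B-pack v)

  packing? : ∀ k → Decidable (IsLimitedPacking G k)
  packing? k B = all? (λ v → count (NbrC G v ∩ B) ℕ.≤? k)

  ∅-packing : ∀ k → IsLimitedPacking G k (λ _ → false)
  ∅-packing k v =
    subst (_≤ k) (≡.sym (trans (count-cong (∧-zeroʳ ∘ NbrC G v)) (count-∅ {n}))) z≤n

  Lk-exists : ∀ k → Σ ℕ (IsLkNumber G k)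
  Lk-exists k with maximum-exists (packing? k) packing-cong (λ _ → false) (∅-packing k)
  ... | B , B-pack , B-max = count B , (B , B-pack , refl) , B-max

  Lk-≤ : ∀ {k l} → IsLkNumber G k l → l ≤ n
  Lk-≤ ((B , _ , refl) , _) = count-≤ B

module RegularGraph {n r : ℕ} (G : Graph n) (regular : Regular G r) where

  private
    k k′ : ℕ
    k  = ⌊ suc r /2⌋
    k′ = ⌈ suc r /2⌉

  closedNbr-split : ∀ (T : VSet n) v →
                    count (NbrC G v ∩ T) ℕ.+ count (NbrC G v ∩ (not ∘ T)) ≡ suc r
  closedNbr-split T v = begin
    count (NbrC G v ∩ T) ℕ.+ count (NbrC G v ∩ (not ∘ T)) ≡⟨ count-∩-not (NbrC G v) T ⟩
    count (NbrC G v)                                      ≡⟨ count-insert v (adj G v) (irrefl G v) ⟩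
    suc (degree G v)                                      ≡⟨ cong suc (regular v) ⟩
    suc r                                                 ∎
    where open ≡-Reasoning

  nnsdf⇒packing : ∀ f → IsNNSDF G f → IsLimitedPacking G k (not ∘ f)
  nnsdf⇒packing f f-nn v = ≤⇒≤⌊/2⌋ (closedNbr-split f v)
    (ℤ.drop‿+≤+ (ℤ.0≤i-j⇒j≤i (subst (ℤ.0ℤ ℤ.≤_) (fsum-count f (NbrC G v)) (f-nn v))))

  packing⇒nnsdf : ∀ B → IsLimitedPacking G k B → IsNNSDF G (not ∘ B)
  packing⇒nnsdf B B-pack v = subst (ℤ.0ℤ ℤ.≤_) (≡.sym (fsum-count f (NbrC G v)))
    (ℤ.i≤j⇒0≤j-i (ℤ.+≤+ (≤⌊/2⌋⇒≤ (closedNbr-split f v)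
                                   (packing-cong G B≗not∘f B-pack v))))
    where
    f = not ∘ B
    B≗not∘f : B ≗ not ∘ f
    B≗not∘f = ≡.sym ∘ not-involutive ∘ B

  tupleDom⇒packing : ∀ D → IsTupleDom G k′ D → IsLimitedPacking G k (not ∘ D)
  tupleDom⇒packing D D-dom v = ⌈/2⌉≤⇒≤⌊/2⌋ (closedNbr-split D v) (D-dom v)

  packing⇒tupleDom : ∀ B → IsLimitedPacking G k B → IsTupleDom G k′ (not ∘ B)
  packing⇒tupleDom B B-pack v = ≤⌊/2⌋⇒⌈/2⌉≤ (closedNbr-split D v)
    (packing-cong G (≡.sym ∘ not-involutive ∘ B) B-pack v)
    where D = not ∘ B

  nnsdNumber : ∀ {l} → IsLkNumber G k l → IsNNSDNumber G (+ n - + 2 * + l)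
  nnsdNumber ((B , B-pack , refl) , B-max) =
      (not ∘ B , packing⇒nnsdf B B-pack
               , trans (fsum-V (not ∘ B)) (cong (λ c → + n - + 2 * + c) (count-not-not B)))
    , λ f f-nn → subst (_ ℤ.≤_) (≡.sym (fsum-V f))
                   (n-2x-antitone n (B-max (not ∘ f) (nnsdf⇒packing f f-nn)))

  tupleDomNumber : ∀ {l} → IsLkNumber G k l → IsTupleDomNumber G k′ (n ∸ l)
  tupleDomNumber ((B , B-pack , refl) , B-max) =
      (not ∘ B , packing⇒tupleDom B B-pack , count-not B)
    , λ D D-dom → subst (n ∸ count B ≤_) (∸-count-not D)
                    (ℕ.∸-monoʳ-≤ n (B-max (not ∘ D) (tupleDom⇒packing D D-dom)))

  nnsd≡n-2Lk : ∀ {g l} → IsNNSDNumber G g → IsLkNumber G k l → g ≡ + n - + 2 * + l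
  nnsd≡n-2Lk g-min l-max = IsNNSDNumber-unique G g-min (nnsdNumber l-max)

  nnsd≡2γ×-n : ∀ {g d} → IsNNSDNumber G g → IsTupleDomNumber G k′ d →
               g ≡ + 2 * + d - + n
  nnsd≡2γ×-n {g} {d} g-min d-min with (l , l-max) ← Lk-exists G k = begin
    g                      ≡⟨ nnsd≡n-2Lk g-min l-max ⟩
    + n - + 2 * + l        ≡⟨ n-2l≡2[n∸l]-n (Lk-≤ G l-max) ⟩
    + 2 * + (n ∸ l) - + n  ≡⟨ cong (λ d → + 2 * + d - + n)
                                   (IsTupleDomNumber-unique G (tupleDomNumber l-max) d-min) ⟩
    + 2 * + d - + n        ∎
    where open ≡-Reasoning

theorem2p1 : (n r : ℕ) (G : Graph n) → Regular G r →
    (Σ ℤ (IsNNSDNumber G)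
      × Σ ℕ (IsLkNumber G ⌊ suc r /2⌋)
      × Σ ℕ (IsTupleDomNumber G ⌈ suc r /2⌉))
    × (∀ g l → IsNNSDNumber G g → IsLkNumber G ⌊ suc r /2⌋ l →
         g ≡ + n - + 2 * + l)
    × (∀ g d → IsNNSDNumber G g → IsTupleDomNumber G ⌈ suc r /2⌉ d →
         g ≡ + 2 * + d - + n)
theorem2p1 n r G regular with (l , l-max) ← Lk-exists G ⌊ suc r /2⌋ =
    ((_ , nnsdNumber l-max) , (l , l-max) , (_ , tupleDomNumber l-max))
  , (λ _ _ → nnsd≡n-2Lk)
  , (λ _ _ → nnsd≡2γ×-n)
  where open RegularGraph G regular
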